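{- There is no Carmichael number $m$ with exactly three prime factors such that $s_p(m)\ne p$ for every prime divisor $p$ of $m$. That is, $\mathcal{C}^\sharp_3=\emptyset$.
   Context: For a prime $p$ and integer $m\ge0$, $s_p(m)$ denotes the sum of the base-$p$ digits of $m$. A Carmichael number is a composite positive integer $m$ with $a^{m-1}\equiv1\pmod m$ for all integers $a$ coprime to $m$. $\mathcal{C}^\sharp$ (exceptional Carmichael numbers) is the set of Carmichael numbers $m$ with $s_p(m)\ne p$ for every prime $p\mid m$, and $\mathcal{C}^\sharp_3$ is the subset of those having exactly three prime factors. -}

module Defs where

open import Data.Nat using (ℕ; zero; suc; _+_; _*_; _∸_; _^_; _<_; _≡ᵇ_)
open import Data.Nat.DivMod using (_/_; _%_)
open import Data.Nat.Divisibility using (_∣_)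
open import Data.Nat.Primality using (Prime; Composite)
open import Data.Nat.Coprimality using (Coprime)
open import Data.Integer as ℤ using (ℤ; +_)
import Data.Integer.Divisibility as ℤD
open import Data.Product using (Σ; _×_; ∃)
open import Data.Sum using (_⊎_)
open import Relation.Binary.PropositionalEquality using (_≡_; _≢_; refl)

-- Sum of base-b digits of m, computed with fuel (fuel ≥ number of digits suffices;
-- we use fuel = m, enough for any base b ≥ 2).
digitSumFuel : (fuel b m : ℕ) → ℕ
digitSumFuel zero    b m = 0
digitSumFuel (suc f) zero m = m
digitSumFuel (suc f) (suc b) zero = 0
digitSumFuel (suc f) (suc b) (suc m) =
  (suc m % suc b) + digitSumFuel f (suc b) (suc m / suc b)

s : (p m : ℕ) → ℕ
s p m = digitSumFuel m p m

Carmichael : ℕ → Set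
Carmichael m =
  Composite m ×
  (∀ (a : ℕ) → Coprime a m → (+ m) ℤD.∣ ((+ (a ^ (m ∸ 1))) ℤ.- (+ 1)))

HasExactlyThreePrimeFactors : ℕ → Set
HasExactlyThreePrimeFactors m =
  Σ ℕ λ p → Σ ℕ λ q → Σ ℕ λ r →
    Prime p × Prime q × Prime r × p < q × q < r ×
    p ∣ m × q ∣ m × r ∣ m ×
    (∀ ℓ → Prime ℓ → ℓ ∣ m → (ℓ ≡ p ⊎ ℓ ≡ q ⊎ ℓ ≡ r))

Exceptional : ℕ → Set
Exceptional m = ∀ p → Prime p → p ∣ m → s p m ≢ p

private
  test1 : s 3 561 ≡ 7
  test1 = refl
  test2 : s 11 561 ≡ 11
  test2 = refl
  test3 : s 10 1234 ≡ 10
  test3 = refl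

module Submission where

-- A Carmichael number m with prime factors p < q < r is squarefree, so m = pq·r, and by
-- Korselt's criterion r - 1 ∣ m - 1. Writing pq = A r + B with 0 ≤ A, B < r, the base-r digits
-- of m are 0, B, A and m - 1 ≡ A + B - 1 (mod r - 1); as 2 ≤ A + B ≤ 2r - 2 this forces
-- A + B = r, i.e. s_r(m) = r. Korselt's criterion comes from Fermat's little theorem (via the
-- binomial theorem) and Lagrange's bound on the number of roots of x^e - 1 modulo a prime.

open import Defs
open import Data.Nat using (ℕ)
open import Data.Product using (_×_)
open import Relation.Nullary using (¬_)

module Congruence where

  open import Data.Nat as ℕ using (zero; suc)
  open import Data.Nat.Primality using (Prime; euclidsLemma)
  import Data.Nat.Divisibility as ℕ
  open import Data.Integer as ℤ using (ℤ; +_; _+_; _-_; -_; _*_; _^_; 0ℤ)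
  open import Data.Integer.Properties using (+-inverseʳ; abs-*)
  open import Data.Integer.Divisibility.Signed
  open import Data.Integer.Tactic.RingSolver using (solve-∀)
  open import Data.Sum using (_⊎_; inj₁; inj₂)
  open import Data.Empty using (⊥-elim)
  open import Relation.Binary.PropositionalEquality
  open import Relation.Binary.Bundles using (Setoid)
  import Relation.Binary.Reasoning.Setoid
  open import Level using (0ℓ)

  infix 4 _≡_mod_
  record _≡_mod_ (a b P : ℤ) : Set where
    constructor ∣-≡mod
    field ≡mod-∣ : P ∣ a - b
  open _≡_mod_ public

  ∣0 : ∀ {P} → P ∣ 0ℤ
  ∣0 = divides 0ℤ refl

  module _ {P : ℤ} where

    mod-reflexive : ∀ {a b} → a ≡ b → a ≡ b mod P
    mod-reflexive {a} refl = ∣-≡mod (subst (P ∣_) (sym (+-inverseʳ a)) ∣0)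

    mod-sym : ∀ {a b} → a ≡ b mod P → b ≡ a mod P
    mod-sym {a} {b} (∣-≡mod d) = ∣-≡mod (subst (P ∣_) (identity a b) (∣m⇒∣-m d))
      where
      identity : ∀ a b → - (a - b) ≡ b - a
      identity = solve-∀

    mod-trans : ∀ {a b c} → a ≡ b mod P → b ≡ c mod P → a ≡ c mod P
    mod-trans {a} {b} {c} (∣-≡mod d) (∣-≡mod e) = ∣-≡mod (subst (P ∣_) (identity a b c) (∣m∣n⇒∣m+n d e))
      where
      identity : ∀ a b c → (a - b) + (b - c) ≡ a - c
      identity = solve-∀

    +-cong-mod : ∀ {a b c d} → a ≡ b mod P → c ≡ d mod P → a + c ≡ b + d mod P
    +-cong-mod {a} {b} {c} {d} (∣-≡mod e) (∣-≡mod f) =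
      ∣-≡mod (subst (P ∣_) (identity a b c d) (∣m∣n⇒∣m+n e f))
      where
      identity : ∀ a b c d → (a - b) + (c - d) ≡ (a + c) - (b + d)
      identity = solve-∀

    *-cong-mod : ∀ {a b c d} → a ≡ b mod P → c ≡ d mod P → a * c ≡ b * d mod P
    *-cong-mod {a} {b} {c} {d} (∣-≡mod e) (∣-≡mod f) =
      ∣-≡mod (subst (P ∣_) (identity a b c d) (∣m∣n⇒∣m+n (∣m⇒∣m*n c e) (∣n⇒∣m*n b f)))
      where
      identity : ∀ a b c d → (a - b) * c + b * (c - d) ≡ a * c - b * d
      identity = solve-∀

    *-congˡ-mod : ∀ a {b c} → b ≡ c mod P → a * b ≡ a * c mod P
    *-congˡ-mod a = *-cong-mod (mod-reflexive {a} refl)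

    +-congˡ-mod : ∀ a {b c} → b ≡ c mod P → a + b ≡ a + c mod P
    +-congˡ-mod a = +-cong-mod (mod-reflexive {a} refl)

    *-congʳ-mod : ∀ a {b c} → b ≡ c mod P → b * a ≡ c * a mod P
    *-congʳ-mod a e = *-cong-mod e (mod-reflexive {a} refl)

    ^-cong-mod : ∀ {a b} n → a ≡ b mod P → a ^ n ≡ b ^ n mod P
    ^-cong-mod zero    e = mod-reflexive refl
    ^-cong-mod (suc n) e = *-cong-mod e (^-cong-mod n e)

    ∣-resp-mod : ∀ {a b} → a ≡ b mod P → P ∣ a → P ∣ b
    ∣-resp-mod {a} {b} (∣-≡mod d) P∣a = subst (P ∣_) (identity a b) (∣m∣n⇒∣m-n P∣a d)
      where
      identity : ∀ a b → a - (a - b) ≡ b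
      identity = solve-∀

    mod-∣ : ∀ {Q a b} → Q ∣ P → a ≡ b mod P → a ≡ b mod Q
    mod-∣ Q∣P (∣-≡mod d) = ∣-≡mod (∣-trans Q∣P d)

  mod-setoid : ℤ → Setoid 0ℓ 0ℓ
  mod-setoid P = record
    { Carrier       = ℤ
    ; _≈_           = λ a b → a ≡ b mod P
    ; isEquivalence = record { refl = mod-reflexive refl ; sym = mod-sym ; trans = mod-trans }
    }

  module ≡-mod-Reasoning (P : ℤ) = Relation.Binary.Reasoning.Setoid (mod-setoid P)

  euclidsLemmaℤ : ∀ {p} → Prime p → ∀ a b → + p ∣ a * b → + p ∣ a ⊎ + p ∣ b
  euclidsLemmaℤ {p} pp a b d with euclidsLemma ℤ.∣ a ∣ ℤ.∣ b ∣ pp (subst (p ℕ.∣_) (abs-* a b) (∣⇒∣ᵤ d))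
  ... | inj₁ p∣a = inj₁ (∣ᵤ⇒∣ p∣a)
  ... | inj₂ p∣b = inj₂ (∣ᵤ⇒∣ p∣b)

  *-cancelˡ-mod : ∀ {p a b c} → Prime p → ¬ + p ∣ a → a * b ≡ a * c mod + p → b ≡ c mod + p
  *-cancelˡ-mod {p} {a} {b} {c} pp p∤a (∣-≡mod d)
    with euclidsLemmaℤ pp a (b - c) (subst (+ p ∣_) (identity a b c) d)
    where
    identity : ∀ a b c → a * b - a * c ≡ a * (b - c)
    identity = solve-∀
  ... | inj₁ p∣a   = ⊥-elim (p∤a p∣a)
  ... | inj₂ p∣b-c = ∣-≡mod p∣b-c

module Polynomial where

  open import Data.Nat as ℕ using (zero; suc; _<_; _≤_; s≤s; z≤n)
  import Data.Nat.Properties as ℕ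
  import Data.Nat.Divisibility as ℕ
  open import Data.Nat.Primality using (Prime; ¬prime[1])
  open import Data.Integer as ℤ using (ℤ; +_; _+_; _-_; _*_; _^_; 0ℤ; 1ℤ)
  open import Data.Integer.Properties using (+-identityʳ; +-injective; i-j≡0⇒i≡j; ∣i∣≡0⇒i≡0; m-n≡m⊖n; ∣m⊝n∣≤m⊔n)
  open import Data.Integer.Divisibility.Signed
  open import Data.Integer.Tactic.RingSolver using (solve-∀)
  open import Data.Fin using (Fin; toℕ)
  open import Data.Fin.Properties using (toℕ-injective; toℕ<n)
  open import Data.Vec using (Vec; []; _∷_; tabulate)
  open import Data.Vec.Relation.Unary.All as All using (All; []; _∷_)
  import Data.Vec.Relation.Unary.All.Properties as All
  open import Data.Vec.Relation.Unary.AllPairs using (AllPairs; []; _∷_)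
  import Data.Vec.Relation.Unary.AllPairs.Properties as AllPairs
  open import Data.Product using (Σ; _,_)
  open import Data.Sum using (inj₁; inj₂)
  open import Data.Empty using (⊥-elim)
  open import Relation.Nullary using (contradiction)
  open import Relation.Binary.PropositionalEquality
  open Congruence

  -- IsPoly n c f : f is a polynomial function of degree at most n with coefficient c
  -- at xⁿ, characterised by the factor theorem: f x = (x - a) g x + f a with g of
  -- degree at most n - 1 and the same leading coefficient.
  IsPoly : ℕ → ℤ → (ℤ → ℤ) → Set
  IsPoly zero    c f = ∀ x → f x ≡ c
  IsPoly (suc n) c f = ∀ a → Σ (ℤ → ℤ) λ g → IsPoly n c g × (∀ x → f x ≡ (x - a) * g x + f a)

  IsPoly-raise : ∀ n {c f} → IsPoly n c f → IsPoly (suc n) 0ℤ f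
  IsPoly-raise zero {c} pf a = (λ _ → 0ℤ) , (λ _ → refl) , λ x →
    trans (pf x) (trans (identity x a c) (cong (λ y → (x - a) * 0ℤ + y) (sym (pf a))))
    where
    identity : ∀ x a c → c ≡ (x - a) * 0ℤ + c
    identity = solve-∀
  IsPoly-raise (suc n) pf a with pf a
  ... | g , pg , eq = g , IsPoly-raise n pg , eq

  IsPoly-+ : ∀ n {c d f g} → IsPoly n c f → IsPoly n d g → IsPoly n (c + d) (λ x → f x + g x)
  IsPoly-+ zero    pf pg x = cong₂ _+_ (pf x) (pg x)
  IsPoly-+ (suc n) {f = f} {g} pf pg a with pf a | pg a
  ... | f′ , pf′ , ef | g′ , pg′ , eg = (λ x → f′ x + g′ x) , IsPoly-+ n pf′ pg′ , λ x →
    trans (cong₂ _+_ (ef x) (eg x)) (identity x a (f′ x) (g′ x) (f a) (g a))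
    where
    identity : ∀ x a u v s t → ((x - a) * u + s) + ((x - a) * v + t) ≡ (x - a) * (u + v) + (s + t)
    identity = solve-∀

  IsPoly-scale : ∀ n k {c f} → IsPoly n c f → IsPoly n (k * c) (λ x → k * f x)
  IsPoly-scale zero    k pf x = cong (k *_) (pf x)
  IsPoly-scale (suc n) k {f = f} pf a with pf a
  ... | g , pg , e = (λ x → k * g x) , IsPoly-scale n k pg , λ x →
    trans (cong (k *_) (e x)) (identity k x a (g x) (f a))
    where
    identity : ∀ k x a u s → k * ((x - a) * u + s) ≡ (x - a) * (k * u) + k * s
    identity = solve-∀

  IsPoly-x* : ∀ n {c f} → IsPoly n c f → IsPoly (suc n) c (λ x → x * f x)
  IsPoly-x* zero {c} {f} pf a = f , pf , λ x →
    trans (cong (x *_) (pf x)) (trans (identity x a c) (cong₂ (λ s t → (x - a) * s + a * t) (sym (pf x)) (sym (pf a))))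
    where
    identity : ∀ x a c → x * c ≡ (x - a) * c + a * c
    identity = solve-∀
  IsPoly-x* (suc n) {c} {f} pf a with pf a
  ... | g , pg , e = (λ x → f x + a * g x) , IsPoly-quotient , λ x →
    trans (cong (x *_) (e x)) (trans (identity x a (g x) (f a)) (cong (λ y → (x - a) * (y + a * g x) + a * f a) (sym (e x))))
    where
    IsPoly-quotient : IsPoly (suc n) c (λ x → f x + a * g x)
    IsPoly-quotient = subst (λ d → IsPoly (suc n) d _) (+-identityʳ c) (IsPoly-+ (suc n) pf (IsPoly-raise n (IsPoly-scale n a pg)))
    identity : ∀ x a G A → x * ((x - a) * G + A) ≡ (x - a) * (((x - a) * G + A) + a * G) + a * A
    identity = solve-∀

  IsPoly-^ : ∀ n → IsPoly n 1ℤ (_^ n)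
  IsPoly-^ zero    x = refl
  IsPoly-^ (suc n) = IsPoly-x* n (IsPoly-^ n)

  IsPoly-minus-const : ∀ n k {c f} → IsPoly (suc n) c f → IsPoly (suc n) c (λ x → f x - k)
  IsPoly-minus-const n k {c} {f} pf a with pf a
  ... | g , pg , e = g , pg , λ x → trans (cong (_- k) (e x)) (identity x a (g x) (f a) k)
    where
    identity : ∀ x a G A k → ((x - a) * G + A) - k ≡ (x - a) * G + (A - k)
    identity = solve-∀

  lagrange : ∀ {p} n {c f} → Prime p → IsPoly n c f → (xs : Vec ℤ (suc n)) →
             AllPairs (λ a b → ¬ a ≡ b mod + p) xs → All (λ x → + p ∣ f x) xs → + p ∣ c
  lagrange zero pp pf (a ∷ []) _ (p∣fa ∷ []) = subst (_ ∣_) (pf a) p∣fa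
  lagrange {p} (suc n) {f = f} pp pf (a ∷ xs) (a≢xs ∷ distinct) (p∣fa ∷ p∣fxs) with pf a
  ... | g , pg , e = lagrange n pp pg xs distinct (All.map root-of-g (All.zip (a≢xs , p∣fxs)))
    where
    root-of-g : ∀ {y} → ¬ a ≡ y mod + p × + p ∣ f y → + p ∣ g y
    root-of-g {y} (a≢y , p∣fy) with euclidsLemmaℤ pp (y - a) (g y) (∣m+n∣n⇒∣m (subst (_ ∣_) (e y) p∣fy) p∣fa)
    ... | inj₁ p∣y-a = ⊥-elim (a≢y (mod-sym (∣-≡mod p∣y-a)))
    ... | inj₂ p∣gy  = p∣gy

  residue-injective : ∀ {p i j} → i < p → j < p → + i ≡ + j mod + p → i ≡ j
  residue-injective {p} {i} {j} i<p j<p (∣-≡mod p∣i-j) with ℤ.∣ + i - + j ∣ in eq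
  ... | zero  = +-injective (i-j≡0⇒i≡j (+ i) (+ j) (∣i∣≡0⇒i≡0 eq))
  ... | suc d = contradiction (subst (p ℕ.∣_) eq (∣⇒∣ᵤ p∣i-j)) (ℕ.>⇒∤ distance<p)
    where
    distance<p : suc d < p
    distance<p = subst (_< p) (trans (sym (cong ℤ.∣_∣ (m-n≡m⊖n i j))) eq)
                   (ℕ.≤-<-trans (∣m⊝n∣≤m⊔n i j) (ℕ.⊔-pres-<m i<p j<p))

  -- x^e - 1 would have p - 1 > e pairwise incongruent roots, so Lagrange gives p ∣ 1.
  all-units-root⇒exponent≡0 : ∀ {p} e → Prime p → e < p ℕ.∸ 1 →
                              (∀ x → 1 ≤ x → x < p → (+ x) ^ e ≡ 1ℤ mod + p) → e ≡ 0
  all-units-root⇒exponent≡0 zero    pp e<p-1 roots = refl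
  all-units-root⇒exponent≡0 {zero}  (suc e) ()
  all-units-root⇒exponent≡0 {suc p} (suc e) pp e<p-1 roots =
    ⊥-elim (¬prime[1] (subst Prime (ℕ.∣1⇒≡1 (∣⇒∣ᵤ p∣1)) pp))
    where
    point : Fin (suc (suc e)) → ℕ
    point i = suc (toℕ i)
    point<p : ∀ i → point i < suc p
    point<p i = s≤s (ℕ.<-≤-trans (toℕ<n i) e<p-1)
    p∣1 : + suc p ∣ 1ℤ
    p∣1 = lagrange (suc e) pp (IsPoly-minus-const e 1ℤ (IsPoly-^ (suc e))) (tabulate (λ i → + point i))
      (AllPairs.tabulate⁺ {f = λ i → + point i} λ i≢j i≡j →
        i≢j (toℕ-injective (ℕ.suc-injective (residue-injective (point<p _) (point<p _) i≡j))))
      (All.tabulate⁺ {f = λ i → + point i} λ i → ≡mod-∣ (roots (point i) (s≤s z≤n) (point<p i)))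

module Fermat where

  open import Data.Nat as ℕ using (zero; suc; _<_; _≤_; s≤s; z≤n; _!)
  import Data.Nat.Properties as ℕ
  import Data.Nat.Divisibility as ℕ
  open import Data.Nat.DivMod using (m/n*n≡m)
  open import Data.Nat.Combinatorics using (_C_; nCn≡1; nCk≡n!/k![n-k]!; k![n∸k]!∣n!)
  open import Data.Nat.Primality using (Prime; euclidsLemma; ¬prime[1])
  open import Data.Fin using (zero; suc; toℕ; fromℕ; inject₁)
  open import Data.Fin.Properties using (toℕ-fromℕ; toℕ-inject₁; toℕ<n)
  open import Data.Vec.Functional using (Vector; init; last; tail)
  open import Data.Integer as ℤ using (ℤ; +_; _+_; _-_; _*_; _^_; 0ℤ; 1ℤ)
  open import Data.Integer.Properties
    using (+-*-semiring; +-*-commutativeSemiring; +-comm; +-identityʳ; *-identityˡ; *-identityʳ; *-distribʳ-+; ^-zeroˡ)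
  open import Data.Integer.Divisibility.Signed
  open import Data.Integer.Tactic.RingSolver using (solve-∀)
  import Algebra.Definitions.RawSemiring as RawSemiring
  open import Algebra.Properties.Semiring.Sum +-*-semiring using (sum; sum-init-last)
  import Algebra.Properties.CommutativeSemiring.Binomial +-*-commutativeSemiring as Binomial
  open import Data.Sum using (inj₁; inj₂)
  open import Data.Empty using (⊥-elim)
  open import Function using (_∘_)
  open import Relation.Binary.PropositionalEquality
  open Congruence

  -- The library's binomial theorem is phrased with the generic semiring power and multiple.
  open RawSemiring ℤ.+-*-rawSemiring using () renaming (_×_ to _×ₛ_; _^_ to _^ₛ_)

  ×ₛ≡* : ∀ n z → n ×ₛ z ≡ + n * z
  ×ₛ≡* zero    z = refl
  ×ₛ≡* (suc n) z = begin
    z + n ×ₛ z        ≡⟨ cong₂ _+_ (sym (*-identityˡ z)) (×ₛ≡* n z) ⟩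
    1ℤ * z + + n * z  ≡⟨ *-distribʳ-+ z 1ℤ (+ n) ⟨
    + suc n * z       ∎
    where open ≡-Reasoning

  ^ₛ≡^ : ∀ x n → x ^ₛ n ≡ x ^ n
  ^ₛ≡^ x zero    = refl
  ^ₛ≡^ x (suc n) = cong (x *_) (^ₛ≡^ x n)

  ∣-sum : ∀ {P n} (f : Vector ℤ n) → (∀ i → P ∣ f i) → P ∣ sum f
  ∣-sum {n = zero}  f P∣f = ∣0
  ∣-sum {n = suc n} f P∣f = ∣m∣n⇒∣m+n (P∣f zero) (∣-sum (tail f) (P∣f ∘ suc))

  prime∤! : ∀ {p} → Prime p → ∀ {j} → j < p → ¬ p ℕ.∣ j !
  prime∤! pp {zero}  _   p∣1 = ¬prime[1] (subst Prime (ℕ.∣1⇒≡1 p∣1) pp)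
  prime∤! pp {suc j} j<p p∣j! with euclidsLemma (suc j) (j !) pp p∣j!
  ... | inj₁ p∣1+j = ℕ.<⇒≱ j<p (ℕ.∣⇒≤ p∣1+j)
  ... | inj₂ p∣j!  = prime∤! pp (ℕ.<-trans (ℕ.n<1+n j) j<p) p∣j!

  -- p ∣ p! = (p C k) k! (p - k)!, and p divides neither factorial.
  prime∣C : ∀ {p k} → Prime p → 0 < k → k < p → p ℕ.∣ p C k
  prime∣C {zero} ()
  prime∣C {p@(suc p-1)} {k} pp 0<k k<p with euclidsLemma (p C k) (k ! ℕ.* (p ℕ.∸ k) !) pp p∣p!
    where
    instance _ = k ℕ.!* (p ℕ.∸ k) !≢0
    p∣p! : p ℕ.∣ (p C k) ℕ.* (k ! ℕ.* (p ℕ.∸ k) !)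
    p∣p! = subst (p ℕ.∣_) (sym (trans (cong (ℕ._* (k ! ℕ.* (p ℕ.∸ k) !)) (nCk≡n!/k![n-k]! (ℕ.<⇒≤ k<p)))
                                        (m/n*n≡m (k![n∸k]!∣n! (ℕ.<⇒≤ k<p)))))
                 (ℕ.m∣m*n (p-1 !))
  ... | inj₁ p∣C = p∣C
  ... | inj₂ p∣k![p-k]! with euclidsLemma (k !) ((p ℕ.∸ k) !) pp p∣k![p-k]!
  ...   | inj₁ p∣k!     = ⊥-elim (prime∤! pp k<p p∣k!)
  ...   | inj₂ p∣[p-k]! = ⊥-elim (prime∤! pp (ℕ.∸-monoʳ-< 0<k (ℕ.<⇒≤ k<p)) p∣[p-k]!)

  -- The binomial coefficients strictly between the two ends are divisible by p.
  freshman's-dream : ∀ {p} → Prime p → ∀ x → (x + 1ℤ) ^ p ≡ x ^ p + 1ℤ mod + p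
  freshman's-dream {zero} ()
  freshman's-dream {suc n} pp x = ∣-≡mod (subst (+ suc n ∣_) (expand⇒middle expansion) p∣middle)
    where
    t : Vector ℤ (suc (suc n))
    t = Binomial.binomialTerm x 1ℤ (suc n)
    middle : ℤ
    middle = sum (init (tail t))

    term : ∀ {k} i → toℕ i ≡ k → t i ≡ (suc n C k) ×ₛ (x ^ₛ k * 1ℤ ^ₛ (suc n ℕ.∸ k))
    term i refl = refl

    first-term : t zero ≡ 1ℤ
    first-term = trans (+-identityʳ _) (trans (*-identityˡ _) (trans (^ₛ≡^ 1ℤ (suc n)) (^-zeroˡ (suc n))))

    last-term : last (tail t) ≡ x ^ suc n
    last-term = begin
      last (tail t)                                          ≡⟨ term (suc (fromℕ n)) (cong suc (toℕ-fromℕ n)) ⟩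
      (suc n C suc n) ×ₛ (x ^ₛ suc n * 1ℤ ^ₛ (n ℕ.∸ n))      ≡⟨ cong (_×ₛ (x ^ₛ suc n * 1ℤ ^ₛ (n ℕ.∸ n))) (nCn≡1 (suc n)) ⟩
      x ^ₛ suc n * 1ℤ ^ₛ (n ℕ.∸ n) + 0ℤ                      ≡⟨ +-identityʳ _ ⟩
      x ^ₛ suc n * 1ℤ ^ₛ (n ℕ.∸ n)                           ≡⟨ cong (λ k → x ^ₛ suc n * 1ℤ ^ₛ k) (ℕ.n∸n≡0 n) ⟩
      x ^ₛ suc n * 1ℤ                                        ≡⟨ *-identityʳ _ ⟩
      x ^ₛ suc n                                             ≡⟨ ^ₛ≡^ x (suc n) ⟩
      x ^ suc n                                              ∎
      where open ≡-Reasoning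

    p∣middle : + suc n ∣ middle
    p∣middle = ∣-sum (init (tail t)) λ j →
      let k = suc (toℕ j); z = x ^ₛ k * 1ℤ ^ₛ (suc n ℕ.∸ k) in
      subst (+ suc n ∣_) (sym (trans (term (suc (inject₁ j)) (cong suc (toℕ-inject₁ j))) (×ₛ≡* (suc n C k) z)))
        (∣m⇒∣m*n z (∣ᵤ⇒∣ {+ suc n} {+ (suc n C k)} (prime∣C pp (s≤s z≤n) (s≤s (toℕ<n j)))))

    expansion : (x + 1ℤ) ^ suc n ≡ 1ℤ + (middle + x ^ suc n)
    expansion = begin
      (x + 1ℤ) ^ suc n              ≡⟨ ^ₛ≡^ (x + 1ℤ) (suc n) ⟨
      (x + 1ℤ) ^ₛ suc n             ≡⟨ Binomial.theorem (suc n) x 1ℤ ⟩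
      t zero + sum (tail t)         ≡⟨ cong₂ _+_ first-term (trans (sum-init-last (tail t)) (cong (λ y → middle + y) last-term)) ⟩
      1ℤ + (middle + x ^ suc n)     ∎
      where open ≡-Reasoning

    expand⇒middle : ∀ {y} → y ≡ 1ℤ + (middle + x ^ suc n) → middle ≡ y - (x ^ suc n + 1ℤ)
    expand⇒middle refl = identity middle (x ^ suc n)
      where
      identity : ∀ M X → M ≡ 1ℤ + (M + X) - (X + 1ℤ)
      identity = solve-∀

  fermat : ∀ {p} → Prime p → ∀ x → (+ x) ^ p ≡ + x mod + p
  fermat {zero}  ()
  fermat {suc n} pp zero    = mod-reflexive refl
  fermat {p}     pp (suc x) = subst (λ y → y ^ p ≡ y mod + p) (+-comm (+ x) 1ℤ)
    (mod-trans (freshman's-dream pp (+ x)) (+-cong-mod (fermat pp x) (mod-reflexive refl)))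

  fermat-unit : ∀ {p x} → Prime p → ¬ p ℕ.∣ x → (+ x) ^ (p ℕ.∸ 1) ≡ 1ℤ mod + p
  fermat-unit {zero} ()
  fermat-unit {suc n} {x} pp p∤x =
    *-cancelˡ-mod {a = + x} pp (p∤x ∘ ∣⇒∣ᵤ) (mod-trans (fermat pp x) (mod-reflexive (sym (*-identityʳ (+ x)))))

module Coprimality where

  open import Data.Nat using (_+_; _*_)
  open import Data.Nat.Properties using (+-comm; *-comm; *-assoc)
  open import Data.Nat.Divisibility using (_∣_; divides; ∣-trans; ∣1⇒≡1; ∣m+n∣m⇒∣n)
  open import Data.Nat.Coprimality using (Coprime; coprime-divisor) renaming (sym to coprime-sym)
  open import Data.Nat.Primality using (Prime; prime⇒irreducible)
  open import Data.Product using (_,_)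
  open import Data.Sum using (inj₁; inj₂)
  open import Data.Empty using (⊥-elim)
  open import Relation.Binary.PropositionalEquality using (refl; subst; trans; cong)

  coprime-*ʳ : ∀ {a n o} → Coprime a n → Coprime a o → Coprime a (n * o)
  coprime-*ʳ a⊥n a⊥o (d∣a , d∣no) =
    a⊥o (d∣a , coprime-divisor (λ (e∣d , e∣n) → a⊥n (∣-trans e∣d d∣a , e∣n)) d∣no)

  coprime-∣ʳ : ∀ {a n m} → Coprime a n → m ∣ n → Coprime a m
  coprime-∣ʳ a⊥n m∣n (d∣a , d∣m) = a⊥n (d∣a , ∣-trans d∣m m∣n)

  coprime-1+ : ∀ {n k} → n ∣ k → Coprime (1 + k) n
  coprime-1+ {k = k} n∣k {d} (d∣1+k , d∣n) =
    ∣1⇒≡1 (∣m+n∣m⇒∣n (subst (d ∣_) (+-comm 1 k) d∣1+k) (∣-trans d∣n n∣k))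

  coprime-∣-* : ∀ {a b m} → Coprime a b → a ∣ m → b ∣ m → a * b ∣ m
  coprime-∣-* {a} {b} a⊥b (divides k m≡ka) b∣m
    with coprime-divisor (coprime-sym a⊥b) (subst (b ∣_) (trans m≡ka (*-comm k a)) b∣m)
  ... | divides j k≡jb =
    divides j (trans m≡ka (trans (cong (_* a) k≡jb) (trans (*-assoc j b a) (cong (j *_) (*-comm b a)))))

  prime∤⇒coprime : ∀ {p a} → Prime p → ¬ p ∣ a → Coprime a p
  prime∤⇒coprime pp p∤a (d∣a , d∣p) with prime⇒irreducible pp d∣p
  ... | inj₁ d≡1 = d≡1
  ... | inj₂ refl = ⊥-elim (p∤a d∣a)

module Korselt where

  open import Data.Nat as ℕ using (zero; suc; _≤_; _<_; _∸_; NonZero)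
  import Data.Nat.Properties as ℕ
  open import Data.Nat.Divisibility as ℕ using (m%n≡0⇒n∣m)
  open import Data.Nat.DivMod using (_%_; _/_; m≡m%n+[m/n]*n; m%n<n)
  open import Data.Nat.Coprimality using (Coprime)
  open import Data.Nat.Primality using (Prime)
  open import Data.Integer as ℤ using (ℤ; +_; _+_; _-_; _*_; _^_; 1ℤ)
  open import Data.Integer.Properties using (pos-*; *-assoc; *-identityʳ; *-identityˡ; ^-distribˡ-+-*; ^-*-assoc; ^-zeroˡ)
  open import Data.Integer.Divisibility.Signed
  open import Data.Product using (∃; _,_)
  open import Relation.Binary.PropositionalEquality
  open Congruence
  open Polynomial using (all-units-root⇒exponent≡0)
  open Fermat using (fermat-unit)
  open Coprimality

  FermatForUnits : ℕ → Set
  FermatForUnits m = ∀ a → Coprime a m → (+ a) ^ (m ∸ 1) ≡ 1ℤ mod + m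

  pos-^ : ∀ a n → + (a ℕ.^ n) ≡ (+ a) ^ n
  pos-^ a zero    = refl
  pos-^ a (suc n) = trans (pos-* a (a ℕ.^ n)) (cong (+ a *_) (pos-^ a n))

  carmichael⇒fermatForUnits : ∀ {m} → Carmichael m → FermatForUnits m
  carmichael⇒fermatForUnits {m} (_ , carmichael) a a⊥m =
    ∣-≡mod (subst (λ y → + m ∣ y - 1ℤ) (pos-^ a (m ∸ 1)) (∣ᵤ⇒∣ (carmichael a a⊥m)))

  ^-%-period-mod : ∀ {P y} R .{{_ : NonZero R}} → y ^ R ≡ 1ℤ mod P → ∀ k → y ^ k ≡ y ^ (k % R) mod P
  ^-%-period-mod {P} {y} R yᴿ≡1 k = begin
    y ^ k                              ≡⟨ cong (y ^_) (m≡m%n+[m/n]*n k R) ⟩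
    y ^ (k % R ℕ.+ k / R ℕ.* R)        ≡⟨ ^-distribˡ-+-* y (k % R) (k / R ℕ.* R) ⟩
    y ^ (k % R) * y ^ (k / R ℕ.* R)    ≡⟨ cong (λ e → y ^ (k % R) * y ^ e) (ℕ.*-comm (k / R) R) ⟩
    y ^ (k % R) * y ^ (R ℕ.* (k / R))  ≡⟨ cong (y ^ (k % R) *_) (^-*-assoc y R (k / R)) ⟨
    y ^ (k % R) * (y ^ R) ^ (k / R)    ≈⟨ *-congˡ-mod (y ^ (k % R)) (^-cong-mod (k / R) yᴿ≡1) ⟩
    y ^ (k % R) * 1ℤ ^ (k / R)         ≡⟨ cong (y ^ (k % R) *_) (^-zeroˡ (k / R)) ⟩
    y ^ (k % R) * 1ℤ                   ≡⟨ *-identityʳ (y ^ (k % R)) ⟩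
    y ^ (k % R)                        ∎
    where open ≡-mod-Reasoning P

  -- 1 + n·nᵖ⁻²·(x - 1) is ≡ 1 modulo n and, by Fermat, ≡ x modulo p.
  unit-lift : ∀ {p n x} → Prime p → ¬ p ℕ.∣ n → .{{NonZero x}} → x < p →
              ∃ λ a → Coprime a (n ℕ.* p) × + a ≡ + x mod + p
  unit-lift {suc (suc t)} {n} {suc x′} pp p∤n x<p = a , coprime-*ʳ {n = n} (coprime-1+ (ℕ.m∣m*n (n ℕ.^ t ℕ.* x′))) a⊥p , a≡x
    where
    p = suc (suc t)
    a : ℕ
    a = 1 ℕ.+ n ℕ.* (n ℕ.^ t ℕ.* x′)
    cast : + (n ℕ.* (n ℕ.^ t ℕ.* x′)) ≡ (+ n) ^ suc t * + x′
    cast = begin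
      + (n ℕ.* (n ℕ.^ t ℕ.* x′))  ≡⟨ pos-* n (n ℕ.^ t ℕ.* x′) ⟩
      + n * + (n ℕ.^ t ℕ.* x′)    ≡⟨ cong (+ n *_) (pos-* (n ℕ.^ t) x′) ⟩
      + n * (+ (n ℕ.^ t) * + x′)  ≡⟨ cong (λ y → + n * (y * + x′)) (pos-^ n t) ⟩
      + n * ((+ n) ^ t * + x′)    ≡⟨ *-assoc (+ n) ((+ n) ^ t) (+ x′) ⟨
      (+ n) ^ suc t * + x′        ∎
      where open ≡-Reasoning
    a≡x : + a ≡ + suc x′ mod + p
    a≡x = begin
      + a                           ≡⟨ cong (_+_ 1ℤ) cast ⟩
      1ℤ + (+ n) ^ suc t * + x′     ≈⟨ +-congˡ-mod 1ℤ (*-congʳ-mod (+ x′) (fermat-unit pp p∤n)) ⟩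
      1ℤ + 1ℤ * + x′                ≡⟨ cong (_+_ 1ℤ) (*-identityˡ (+ x′)) ⟩
      + suc x′                      ∎
      where open ≡-mod-Reasoning (+ p)
    a⊥p : Coprime a p
    a⊥p = prime∤⇒coprime pp λ p∣a → ℕ.>⇒∤ x<p (∣⇒∣ᵤ (∣-resp-mod a≡x (∣ᵤ⇒∣ p∣a)))

  korselt : ∀ {p n} → Prime p → ¬ p ℕ.∣ n → FermatForUnits (n ℕ.* p) → (p ∸ 1) ℕ.∣ (n ℕ.* p ∸ 1)
  korselt {zero} ()
  korselt {suc zero} ()
  korselt {p@(suc (suc t))} {n} pp p∤n units =
    m%n≡0⇒n∣m E (suc t) (all-units-root⇒exponent≡0 (E % suc t) pp (m%n<n E (suc t)) roots)
    where
    E = n ℕ.* p ∸ 1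
    roots : ∀ x → 1 ≤ x → x < p → (+ x) ^ (E % suc t) ≡ 1ℤ mod + p
    roots x@(suc _) _ x<p =
      let a , a⊥np , a≡x = unit-lift pp p∤n x<p
          open ≡-mod-Reasoning (+ p)
      in begin
      (+ x) ^ (E % suc t)  ≈⟨ ^-%-period-mod (suc t) (fermat-unit pp (ℕ.>⇒∤ x<p)) E ⟨
      (+ x) ^ E            ≈⟨ ^-cong-mod E a≡x ⟨
      (+ a) ^ E            ≈⟨ mod-∣ (∣ᵤ⇒∣ {+ p} {+ (n ℕ.* p)} (ℕ.n∣m*n n)) (units a a⊥np) ⟩
      1ℤ                   ∎

module Squarefree where

  open import Data.Nat as ℕ using (zero; suc; _<_; NonZero; nonTrivial⇒n>1)
  import Data.Nat.Properties as ℕ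
  import Data.Nat.Divisibility as ℕ
  open import Data.Nat.Primality using (Prime; prime⇒nonTrivial)
  open import Data.Integer as ℤ using (ℤ; +_; _+_; _-_; _*_; _^_; 0ℤ; 1ℤ)
  open import Data.Integer.Properties using (pos-*)
  open import Data.Integer.Divisibility.Signed
  open import Data.Integer.Tactic.RingSolver using (solve-∀)
  import Data.Nat.Tactic.RingSolver as ℕSolver
  open import Relation.Binary.PropositionalEquality
  open Congruence
  open Coprimality
  open Korselt using (FermatForUnits)

  Squarefree : ℕ → Set
  Squarefree m = ∀ ℓ → Prime ℓ → ¬ ℓ ℕ.* ℓ ℕ.∣ m

  1+x^k-mod : ∀ {P x} → P ∣ x * x → ∀ k → (1ℤ + x) ^ k ≡ 1ℤ + + k * x mod P
  1+x^k-mod {P} {x} P∣x² zero    = mod-reflexive (identity x)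
    where
    identity : ∀ x → 1ℤ ≡ 1ℤ + 0ℤ * x
    identity = solve-∀
  1+x^k-mod {P} {x} P∣x² (suc k) = begin
    (1ℤ + x) * (1ℤ + x) ^ k            ≈⟨ *-congˡ-mod (1ℤ + x) (1+x^k-mod P∣x² k) ⟩
    (1ℤ + x) * (1ℤ + + k * x)          ≈⟨ ∣-≡mod (subst (P ∣_) (identity x (+ k)) (∣n⇒∣m*n (+ k) P∣x²)) ⟩
    1ℤ + (1ℤ + + k) * x                ∎
    where
    open ≡-mod-Reasoning P
    identity : ∀ x k → k * (x * x) ≡ (1ℤ + x) * (1ℤ + k * x) - (1ℤ + (1ℤ + k) * x)
    identity = solve-∀

  -- If ℓ² ∣ m = N ℓ then m ∣ N², so (1 + N)^(m-1) ≡ 1 - N (mod m), forcing m ∣ N < m.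
  fermatForUnits⇒squarefree : ∀ {m} .{{_ : NonZero m}} → FermatForUnits m → Squarefree m
  fermatForUnits⇒squarefree {m@(suc E)} units ℓ pℓ (ℕ.divides c m≡cℓℓ) =
    ℕ.<⇒≱ (subst (N <_) (sym m≡Nℓ) (ℕ.m<m*n N ℓ (nonTrivial⇒n>1 ℓ))) (ℕ.∣⇒≤ (∣⇒∣ᵤ m∣N))
    where
    instance
      _ = prime⇒nonTrivial pℓ
    N = c ℕ.* ℓ
    m≡Nℓ : m ≡ N ℕ.* ℓ
    m≡Nℓ = trans m≡cℓℓ (sym (ℕ.*-assoc c ℓ ℓ))
    instance
      _ = ℕ.m*n≢0⇒m≢0 N {{subst NonZero m≡Nℓ _}}
    m∣N² : m ℕ.∣ N ℕ.* N
    m∣N² = ℕ.divides c (trans (square c ℓ) (cong (c ℕ.*_) (sym m≡cℓℓ)))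
      where
      square : ∀ c ℓ → (c ℕ.* ℓ) ℕ.* (c ℕ.* ℓ) ≡ c ℕ.* (c ℕ.* (ℓ ℕ.* ℓ))
      square = ℕSolver.solve-∀
    fermat-1+N : 1ℤ + + E * + N ≡ 1ℤ mod + m
    fermat-1+N = begin
      1ℤ + + E * + N   ≈⟨ 1+x^k-mod (subst (+ m ∣_) (pos-* N N) (∣ᵤ⇒∣ m∣N²)) E ⟨
      (1ℤ + + N) ^ E   ≈⟨ units (1 ℕ.+ N) (coprime-∣ʳ (coprime-*ʳ 1+N⊥N 1+N⊥N) m∣N²) ⟩
      1ℤ               ∎
      where
      open ≡-mod-Reasoning (+ m)
      1+N⊥N = coprime-1+ (ℕ.∣-refl {N})
    m∣N : + m ∣ + N
    m∣N = subst (+ m ∣_) (identity (+ E) (+ N)) (∣m∣n⇒∣m-n (∣m⇒∣m*n (+ N) ∣-refl) (≡mod-∣ fermat-1+N))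
      where
      identity : ∀ E N → (1ℤ + E) * N - ((1ℤ + E * N) - 1ℤ) ≡ N
      identity = solve-∀

module DigitSum where

  open import Data.Nat using (zero; suc; pred; _+_; _*_; _∸_; _≤_; _<_; s≤s; s≤s⁻¹; z≤n; >-nonZero)
  open import Data.Nat.Properties
  open import Data.Nat.Divisibility using (_∣_; divides; ∣m+n∣m⇒∣n; m∣m*n; m%n≡0⇒n∣m)
  open import Data.Nat.DivMod using (_/_; _%_; m≡m%n+[m/n]*n; m%n<n; m*n%n≡0; m*n/n≡m; m<n⇒m%n≡m; m<n⇒m/n≡0; m<n*o⇒m/o<n)
  open import Data.Nat.Tactic.RingSolver using (solve-∀)
  open import Relation.Nullary using (contradiction)
  open import Relation.Binary.PropositionalEquality

  digitSumFuel-zero : ∀ fuel b → digitSumFuel fuel (suc b) 0 ≡ 0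
  digitSumFuel-zero zero    b = refl
  digitSumFuel-zero (suc f) b = refl

  digitSumFuel-step : ∀ fuel b x → digitSumFuel (suc fuel) (suc b) x ≡ x % suc b + digitSumFuel fuel (suc b) (x / suc b)
  digitSumFuel-step fuel b zero    = sym (digitSumFuel-zero fuel b)
  digitSumFuel-step fuel b (suc x) = refl

  -- n r has the base-r digits 0, n % r, n / r; three steps of fuel read them off.
  digitSumFuel-shifted-two-digits : ∀ fuel R n → 3 ≤ fuel → n / suc R < suc R →
                                    digitSumFuel fuel (suc R) (n * suc R) ≡ n % suc R + n / suc R
  digitSumFuel-shifted-two-digits (suc zero)          R n (s≤s ()) _
  digitSumFuel-shifted-two-digits (suc (suc zero))    R n (s≤s (s≤s ())) _
  digitSumFuel-shifted-two-digits (suc (suc (suc f))) R n _ n/r<r = begin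
    digitSumFuel (3 + f) r (n * r)                        ≡⟨ digitSumFuel-step (2 + f) R (n * r) ⟩
    (n * r) % r + digitSumFuel (2 + f) r ((n * r) / r)    ≡⟨ cong₂ (λ a b → a + digitSumFuel (2 + f) r b) (m*n%n≡0 n r) (m*n/n≡m n r) ⟩
    digitSumFuel (2 + f) r n                              ≡⟨ digitSumFuel-step (1 + f) R n ⟩
    n % r + digitSumFuel (1 + f) r (n / r)                ≡⟨ cong (n % r +_) (digitSumFuel-step f R (n / r)) ⟩
    n % r + ((n / r) % r + digitSumFuel f r ((n / r) / r)) ≡⟨ cong₂ (λ a b → n % r + (a + digitSumFuel f r b)) (m<n⇒m%n≡m n/r<r) (m<n⇒m/n≡0 n/r<r) ⟩
    n % r + (n / r + digitSumFuel f r 0)                  ≡⟨ cong (λ z → n % r + (n / r + z)) (digitSumFuel-zero f R) ⟩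
    n % r + (n / r + 0)                                   ≡⟨ cong (n % r +_) (+-identityʳ (n / r)) ⟩
    n % r + n / r                                         ∎
    where
    open ≡-Reasoning
    r = suc R

  multiple-between-R-and-2R : ∀ {R w} → R ∣ w → 0 < w → w < R + R → w ≡ R
  multiple-between-R-and-2R {R} (divides zero          refl) ()
  multiple-between-R-and-2R {R} (divides (suc zero)    refl) _ _ = +-identityʳ R
  multiple-between-R-and-2R {R} (divides (suc (suc k)) refl) _ w<2R =
    contradiction w<2R (≤⇒≯ (+-monoʳ-≤ R (m≤m+n R (k * R))))

  -- n r ≡ n % r + n / r (mod r - 1), and that digit sum lies in [2, 2r - 2].
  digits-sum-to-base : ∀ R n → 2 ≤ n → n < suc R * suc R → ¬ suc R ∣ n → R ∣ n * suc R ∸ 1 →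
                       n % suc R + n / suc R ≡ suc R
  digits-sum-to-base R n 2≤n n<r² r∤n R∣nr-1 = begin
    B + A          ≡⟨ +-comm B A ⟩
    A + B          ≡⟨ suc-pred (A + B) ⟨
    suc w          ≡⟨ cong suc (multiple-between-R-and-2R R∣w 0<w w<2R) ⟩
    suc R          ∎
    where
    open ≡-Reasoning
    r = suc R
    A = n / r
    B = n % r
    n≡B+Ar : n ≡ B + A * r
    n≡B+Ar = m≡m%n+[m/n]*n n r
    1≤B : 1 ≤ B
    1≤B = n≢0⇒n>0 (λ B≡0 → r∤n (m%n≡0⇒n∣m n r B≡0))
    2≤A+B : 2 ≤ A + B
    2≤A+B with n / r in A≡
    ... | zero  = subst (2 ≤_) (trans n≡B+Ar (trans (cong (λ a → B + a * r) A≡) (+-identityʳ B))) 2≤n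
    ... | suc a = s≤s (≤-trans 1≤B (m≤n+m B a))
    instance
      _ = >-nonZero (≤-trans (s≤s z≤n) 2≤A+B)
    w = pred (A + B)
    0<w : 0 < w
    0<w = pred-mono-≤ 2≤A+B
    w<2R : w < R + R
    w<2R = <-≤-trans (≤-reflexive (suc-pred (A + B))) (+-mono-≤ (s≤s⁻¹ (m<n*o⇒m/o<n n<r²)) (s≤s⁻¹ (m%n<n n r)))
    nr≡ : n * r ≡ (A + B) + R * (A + n)
    nr≡ = trans (cong (_* r) n≡B+Ar) (trans (identity A B R) (cong (λ m → (A + B) + R * (A + m)) (sym n≡B+Ar)))
      where
      identity : ∀ A B R → (B + A * suc R) * suc R ≡ (A + B) + R * (A + (B + A * suc R))
      identity = solve-∀
    R∣w : R ∣ w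
    R∣w = ∣m+n∣m⇒∣n (subst (R ∣_) nr-1≡ R∣nr-1) (m∣m*n (A + n))
      where
      nr-1≡ : n * r ∸ 1 ≡ R * (A + n) + w
      nr-1≡ = trans (cong (_∸ 1) (trans nr≡ (cong (_+ R * (A + n)) (sym (suc-pred (A + B))))))
                    (+-comm w (R * (A + n)))

  digitSum[n*r]≡r : ∀ {r n} → 2 ≤ r → 2 ≤ n → n < r * r → ¬ r ∣ n → r ∸ 1 ∣ n * r ∸ 1 → s r (n * r) ≡ r
  digitSum[n*r]≡r {suc R} {n} (s≤s 1≤R) 2≤n n<r² r∤n R∣nr-1 =
    trans (digitSumFuel-shifted-two-digits (n * suc R) R n 3≤nr (m<n*o⇒m/o<n n<r²))
          (digits-sum-to-base R n 2≤n n<r² r∤n R∣nr-1)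
    where
    3≤nr : 3 ≤ n * suc R
    3≤nr = ≤-trans (s≤s (s≤s (s≤s z≤n))) (*-mono-≤ 2≤n (s≤s 1≤R))

module PrimeFactors where

  open import Data.Nat using (_*_; _<_; NonZero)
  open import Data.Nat.Properties using (<-trans; *-identityˡ; *-comm; m*n≢0⇒m≢0; _≟_)
  open import Data.Nat.ListAction using (product)
  open import Data.Nat.Divisibility using (_∣_; divides; ∣-trans; >⇒∤; *-pres-∣; m∣m*n; n∣m*n; ∣m⇒∣m*n)
  open import Data.Nat.Primality using (Prime; euclidsLemma; prime⇒nonZero)
  open import Data.Nat.Primality.Factorisation using (factorise)
  open import Data.List using ([]; _∷_)
  open import Data.List.Relation.Unary.All using (_∷_)
  open import Data.Product using (∃; _,_)
  open import Data.Sum using (_⊎_; inj₁; inj₂; [_,_]′)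
  open import Data.Empty using (⊥-elim)
  open import Function using (_∘_)
  open import Relation.Nullary using (yes; no)
  open import Relation.Binary.PropositionalEquality
  open Coprimality
  open Squarefree using (Squarefree)

  prime-divisor : ∀ {n} .{{_ : NonZero n}} → n ≢ 1 → ∃ λ u → Prime u × u ∣ n
  prime-divisor {n} n≢1 with factorise n
  ... | record { factors = [] ; isFactorisation = n≡1 } = ⊥-elim (n≢1 n≡1)
  ... | record { factors = u ∷ us ; isFactorisation = n≡u*us ; factorsPrime = pu ∷ _ } =
    u , pu , divides (product us) (trans n≡u*us (*-comm u (product us)))

  larger-prime∤* : ∀ {p q r} → Prime p → Prime q → Prime r → p < r → q < r → ¬ r ∣ p * q
  larger-prime∤* {p} {q} pp pq pr p<r q<r =
    [ >⇒∤ {{prime⇒nonZero pp}} p<r , >⇒∤ {{prime⇒nonZero pq}} q<r ]′ ∘ euclidsLemma p q pr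

  squarefree⇒≡pqr : ∀ {m p q r} .{{m≢0 : NonZero m}} → Squarefree m →
                    Prime p → Prime q → Prime r → p < q → q < r → p ∣ m → q ∣ m → r ∣ m →
                    (∀ ℓ → Prime ℓ → ℓ ∣ m → ℓ ≡ p ⊎ ℓ ≡ q ⊎ ℓ ≡ r) → m ≡ p * q * r
  squarefree⇒≡pqr {m} {p} {q} {r} {{m≢0}} squarefree pp pq pr p<q q<r p∣m q∣m r∣m only-pqr
    with coprime-∣-* (prime∤⇒coprime pr (larger-prime∤* pp pq pr (<-trans p<q q<r) q<r))
                     (coprime-∣-* (prime∤⇒coprime pq (>⇒∤ {{prime⇒nonZero pp}} p<q)) p∣m q∣m) r∣m
  ... | divides c m≡c*pqr = trans m≡c*pqr (trans (cong (_* (p * q * r)) c≡1) (*-identityˡ (p * q * r)))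
    where
    c≡1 : c ≡ 1
    c≡1 with c ≟ 1
    ... | yes c≡1 = c≡1
    ... | no c≢1 with prime-divisor {{m*n≢0⇒m≢0 c {{subst NonZero m≡c*pqr m≢0}}}} c≢1
    ...   | u , pu , u∣c = ⊥-elim (squarefree u pu (subst (u * u ∣_) (sym m≡c*pqr) (*-pres-∣ u∣c u∣pqr)))
      where
      u∣pqr : u ∣ p * q * r
      u∣pqr with only-pqr u pu (∣-trans u∣c (divides (p * q * r) (trans m≡c*pqr (*-comm c _))))
      ... | inj₁ refl        = ∣m⇒∣m*n r (m∣m*n q)
      ... | inj₂ (inj₁ refl) = ∣m⇒∣m*n r (n∣m*n p)
      ... | inj₂ (inj₂ refl) = n∣m*n (p * q)

open import Data.Nat using (_∸_; _*_; _≤_; _<_; nonTrivial⇒n>1)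
open import Data.Nat.Properties using (≤-trans; <-trans; m≤m*n; *-mono-<)
open import Data.Nat.Divisibility using (_∣_)
open import Data.Nat.Primality using (composite⇒nonZero; prime⇒nonZero; prime⇒nonTrivial)
open import Data.Product using (_,_)
open import Relation.Binary.PropositionalEquality using (_≡_; sym; subst)
open Korselt using (FermatForUnits; carmichael⇒fermatForUnits; korselt)
open Squarefree using (fermatForUnits⇒squarefree)
open DigitSum using (digitSum[n*r]≡r)
open PrimeFactors using (squarefree⇒≡pqr; larger-prime∤*)

theorem3p1 : ∀ (m : ℕ) → ¬ (Carmichael m × HasExactlyThreePrimeFactors m × Exceptional m)
theorem3p1 m (carmichael@(composite , _) , (p , q , r , pp , pq , pr , p<q , q<r , p∣m , q∣m , r∣m , only-pqr) , exceptional) =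
  exceptional r pr r∣m (subst (λ k → s r k ≡ r) (sym m≡pqr) (digitSum[n*r]≡r 2≤r 2≤pq pq<r² r∤pq r-1∣pqr-1))
  where
  instance _ = composite⇒nonZero composite
  units : FermatForUnits m
  units = carmichael⇒fermatForUnits carmichael
  m≡pqr : m ≡ p * q * r
  m≡pqr = squarefree⇒≡pqr (fermatForUnits⇒squarefree units) pp pq pr p<q q<r p∣m q∣m r∣m only-pqr
  r∤pq : ¬ r ∣ p * q
  r∤pq = larger-prime∤* pp pq pr (<-trans p<q q<r) q<r
  r-1∣pqr-1 : r ∸ 1 ∣ p * q * r ∸ 1
  r-1∣pqr-1 = korselt pr r∤pq (subst FermatForUnits m≡pqr units)
  2≤r : 2 ≤ r
  2≤r = nonTrivial⇒n>1 r {{prime⇒nonTrivial pr}}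
  2≤pq : 2 ≤ p * q
  2≤pq = ≤-trans (nonTrivial⇒n>1 p {{prime⇒nonTrivial pp}}) (m≤m*n p q {{prime⇒nonZero pq}})
  pq<r² : p * q < r * r
  pq<r² = *-mono-< (<-trans p<q q<r) q<r
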